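{- Let $S_n(t,q)=\sum_{\pi\in B_n} t^{\mathrm{fdes}(\pi)}q^{\mathrm{fmaj}(\pi)}$ for $n\ge 1$ and $S_0(t,q)=1$. Then for every positive integer $n$, \[ S_n(t,q)=\bigl(1+tq+t^2q^2[2n-2]_q\bigr)S_{n-1}(t,q)+tq(1-t)(1+tq)\,\delta_t\bigl(S_{n-1}(t,q)\bigr). \]
   Context: $[i]_q=1+q+\dots+q^{i-1}$ for $i\in\mathbb{N}$ (so $[0]_q=0$). The operator $\delta_t:\mathbb{Q}[q,t]\to\mathbb{Q}[q,t]$ is $\delta_t(P(q,t))=\frac{P(q,qt)-P(q,t)}{qt-t}$. $B_n$ is the hyperoctahedral group: bijections $\pi$ of $[-n,n]\setminus\{0\}$ onto itself with $\pi(-a)=-\pi(a)$, with composition as product; write $\pi=[\pi(1),\dots,\pi(n)]$. Let $\mathrm{des}_A(\pi)=|\{i\in[n-1]:\pi(i)>\pi(i+1)\}|$, $\mathrm{maj}_A(\pi)=\sum_{i\in[n-1],\ \pi(i)>\pi(i+1)} i$, $\mathrm{neg}(\pi)=|\{i\in[n]:\pi(i)<0\}|$. For $i=0,\dots,n-1$ let $t_i=[-i-1,1,2,\dots,i,i+2,\dots,n]$. Every $\pi\in B_n$ has a unique expression $\pi=t_{n-1}^{k_{n-1}}\cdots t_1^{k_1}t_0^{k_0}$ with $0\le k_i\le 2i+1$; $\mathrm{fmaj}(\pi)=\sum_i k_i$ (it is known that $\mathrm{fmaj}(\pi)=2\,\mathrm{maj}_A(\pi)+\mathrm{neg}(\pi)$).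 $\mathrm{fdes}(\pi)=2\,\mathrm{des}_A(\pi)+\varepsilon_1(\pi)$, where $\varepsilon_1(\pi)=1$ if $\pi(1)<0$ and $0$ otherwise. -}

module Defs where

open import Data.Nat as ℕ using (ℕ; zero; suc)
open import Data.Integer as ℤ using (ℤ; +_; -_; _<?_)
open import Data.List using (List; []; _∷_; [_]; map; concatMap; upTo; _++_; foldr; length)
open import Data.Product using (_×_; _,_)
open import Relation.Nullary using (yes; no)
open import Relation.Nullary.Decidable using (⌊_⌋)
open import Data.Bool using (Bool; true; false; if_then_else_; _∧_)
open import Relation.Binary.PropositionalEquality using (_≡_)

-- Hyperoctahedral group B_n, elements written in window notation
-- [π(1),…,π(n)] as lists of nonzero integers.

SignedPerm : Set
SignedPerm = List ℤ

insertAll : {A : Set} → A → List A → List (List A)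
insertAll x []       = [ x ∷ [] ]
insertAll x (y ∷ ys) = (x ∷ y ∷ ys) ∷ map (y ∷_) (insertAll x ys)

perms : {A : Set} → List A → List (List A)
perms []       = [ [] ]
perms (x ∷ xs) = concatMap (insertAll x) (perms xs)

signings : List ℕ → List (List ℤ)
signings []       = [ [] ]
signings (x ∷ xs) = concatMap (λ s → ((+ x) ∷ s) ∷ ((- (+ x)) ∷ s) ∷ []) (signings xs)

B : ℕ → List SignedPerm
B n = concatMap signings (perms (map suc (upTo n)))

majFrom : ℕ → List ℤ → ℕ
majFrom i []           = 0
majFrom i (x ∷ [])     = 0
majFrom i (x ∷ y ∷ r)  = (if ⌊ y <? x ⌋ then i else 0) ℕ.+ majFrom (suc i) (y ∷ r)

desList : List ℤ → ℕ
desList []          = 0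
desList (x ∷ [])    = 0
desList (x ∷ y ∷ r) = (if ⌊ y <? x ⌋ then 1 else 0) ℕ.+ desList (y ∷ r)

desA : SignedPerm → ℕ
desA = desList

majA : SignedPerm → ℕ
majA = majFrom 1

neg : SignedPerm → ℕ
neg []      = 0
neg (x ∷ r) = (if ⌊ x <? + 0 ⌋ then 1 else 0) ℕ.+ neg r

ε₁ : SignedPerm → ℕ
ε₁ []      = 0
ε₁ (x ∷ r) = if ⌊ x <? + 0 ⌋ then 1 else 0

-- fmaj = 2 maj_A + neg  (the known formula for the flag major index)
fmaj : SignedPerm → ℕ
fmaj π = 2 ℕ.* majA π ℕ.+ neg π

fdes : SignedPerm → ℕ
fdes π = 2 ℕ.* desA π ℕ.+ ε₁ π

-- Polynomials in ℤ[q,t] as formal sums of terms c·q^a·t^b,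
-- compared coefficientwise.

Term : Set
Term = ℤ × ℕ × ℕ          -- (c , a , b) means c q^a t^b

Poly : Set
Poly = List Term

coeff : ℕ → ℕ → Poly → ℤ
coeff a b = foldr (λ { (c , a' , b') s →
  (if ⌊ a ℕ.≟ a' ⌋ ∧ ⌊ b ℕ.≟ b' ⌋ then c else + 0) ℤ.+ s }) (+ 0)

_≈P_ : Poly → Poly → Set
P ≈P Q = ∀ a b → coeff a b P ≡ coeff a b Q
infix 4 _≈P_

mono : ℤ → ℕ → ℕ → Poly
mono c a b = [ (c , a , b) ]

1P : Poly
1P = mono (+ 1) 0 0

_+P_ : Poly → Poly → Poly
P +P Q = P ++ Q
infixl 6 _+P_

_*P_ : Poly → Poly → Poly
P *P Q = concatMap (λ { (c , a , b) →
  map (λ { (d , a' , b') → (c ℤ.* d , a ℕ.+ a' , b ℕ.+ b') }) Q }) P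
infixl 7 _*P_

qint : ℕ → Poly
qint m = map (λ j → (+ 1 , j , 0)) (upTo m)

-- δ_t P = (P(q,qt) - P(q,t)) / (qt - t), computed on monomials:
-- δ_t (q^a t^b) = q^a t^(b-1) [b]_q   (and 0 for b = 0), extended linearly.
δt : Poly → Poly
δt = concatMap (λ { (c , a , zero)  → []
                  ; (c , a , suc b) → map (λ j → (c , a ℕ.+ j , b)) (upTo (suc b)) })

S : ℕ → Poly
S zero    = 1P
S (suc n) = map (λ π → (+ 1 , fmaj π , fdes π)) (B (suc n))

-- Every element of B_(m+1) arises exactly once by inserting +1 or -1 into one of the
-- m + 1 slots of an element u of B_m whose letters have been pushed away from zero
-- (x ↦ x ± 1).  By the classical insertion lemma, the n + 1 insertions of a new letter into
-- a word raise maj by 0, 1, …, n, and raise des by one exactly for the increments c > des.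
-- Since fmaj = 2 majA + neg and fdes = 2 desA + ε₁, the 2(m + 1) signed insertions then
-- raise fmaj by j = 0, 1, …, 2m + 1 and fdes by 0, 1 or 2 according as j ≤ fdes u,
-- j = fdes u + 1 or j > fdes u + 1; only the two insertions in front, which change ε₁,
-- need separate bookkeeping.  On a monomial q^A t^B with B ≤ 2m, the right-hand side of
-- the recurrence produces exactly these 2(m + 1) monomials, because δ_t (q^A t^B) =
-- q^A t^(B-1) [B]_q and the factor t q (1 - t)(1 + t q) telescopes; the theorem follows
-- coefficientwise by linearity.

module Submission where

open import Defs
open import Data.Nat using (ℕ; _≥_; _∸_; _*_)
open import Data.Integer using (+_; -_)

open import Data.Bool using (Bool; true; false; if_then_else_; _∧_)
open import Data.Empty using (⊥-elim)
open import Data.Integer as ℤ using (ℤ; -[1+_])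
import Data.Integer.Properties as ℤ
import Data.Integer.Tactic.RingSolver as ℤ-Solver
open import Data.List using (List; []; _∷_; [_]; _++_; map; concatMap; length; upTo; applyUpTo)
import Data.List.Properties as List
open import Data.List.Relation.Binary.Permutation.Propositional
  using (_↭_; ↭-refl; ↭-prep; ↭-swap; ↭-trans; ↭-sym)
open import Data.List.Relation.Binary.Permutation.Propositional.Properties using (↭-length; All-resp-↭)
open import Data.List.Relation.Unary.All as All using (All; []; _∷_)
import Data.List.Relation.Unary.All.Properties as All
open import Data.Nat as ℕ using (zero; suc; _+_; _≤_; _<_; z≤n; s≤s)
import Data.Nat.Properties as ℕ
open import Data.Nat.Tactic.RingSolver using (solve-∀)
open import Algebra.Properties.CommutativeSemigroup ℕ.+-commutativeSemigroup
  using (interchange; x∙yz≈y∙xz; x∙yz≈z∙xy; xy∙z≈xz∙y; xy∙z≈zy∙x)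
import Algebra.Properties.CommutativeSemigroup ℤ.+-commutativeSemigroup as ℤ-CS
open import Data.Product using (_,_)
open import Function using (_∘_)
open import Function.Bundles using (mk⇔)
open import Relation.Binary.Definitions using (tri<; tri≈; tri>)
open import Relation.Binary.PropositionalEquality
  using (_≡_; _≢_; _≗_; refl; sym; trans; cong; cong₂; subst; module ≡-Reasoning)
open import Relation.Nullary using (Dec; yes; no; ¬_)
open import Relation.Nullary.Decidable using (⌊_⌋; isYes≗does; dec-true; dec-false; does-⇔)

∑ : {A : Set} → (A → ℕ) → List A → ℕ
∑ F []       = 0
∑ F (x ∷ xs) = F x + ∑ F xs

module _ {A : Set} where

  ∑-++ : (F : A → ℕ) (xs ys : List A) → ∑ F (xs ++ ys) ≡ ∑ F xs + ∑ F ys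
  ∑-++ F []       ys = refl
  ∑-++ F (x ∷ xs) ys = trans (cong (_+_ (F x)) (∑-++ F xs ys)) (sym (ℕ.+-assoc (F x) _ _))

  ∑-cong : {F G : A → ℕ} → F ≗ G → ∑ F ≗ ∑ G
  ∑-cong F≗G []       = refl
  ∑-cong F≗G (x ∷ xs) = cong₂ _+_ (F≗G x) (∑-cong F≗G xs)

  ∑-cong-local : {F G : A → ℕ} {xs : List A} → All (λ x → F x ≡ G x) xs → ∑ F xs ≡ ∑ G xs
  ∑-cong-local []       = refl
  ∑-cong-local (e ∷ es) = cong₂ _+_ e (∑-cong-local es)

  ∑-+ : (F G : A → ℕ) (xs : List A) → ∑ (λ x → F x + G x) xs ≡ ∑ F xs + ∑ G xs
  ∑-+ F G []       = refl
  ∑-+ F G (x ∷ xs) = trans (cong (_+_ (F x + G x)) (∑-+ F G xs)) (interchange (F x) (G x) (∑ F xs) (∑ G xs))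

module _ {A B : Set} where

  ∑-map : (F : B → ℕ) (f : A → B) (xs : List A) → ∑ F (map f xs) ≡ ∑ (F ∘ f) xs
  ∑-map F f []       = refl
  ∑-map F f (x ∷ xs) = cong (_+_ (F (f x))) (∑-map F f xs)

  ∑-concatMap : (F : B → ℕ) (f : A → List B) (xs : List A) →
                ∑ F (concatMap f xs) ≡ ∑ (∑ F ∘ f) xs
  ∑-concatMap F f []       = refl
  ∑-concatMap F f (x ∷ xs) = trans (∑-++ F (f x) (concatMap f xs)) (cong (_+_ (∑ F (f x))) (∑-concatMap F f xs))

sumUpTo : ℕ → (ℕ → ℕ) → ℕ
sumUpTo zero    f = 0
sumUpTo (suc n) f = f 0 + sumUpTo n (f ∘ suc)

∑-applyUpTo : (F : ℕ → ℕ) (f : ℕ → ℕ) (n : ℕ) → ∑ F (applyUpTo f n) ≡ sumUpTo n (F ∘ f)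
∑-applyUpTo F f zero    = refl
∑-applyUpTo F f (suc n) = cong (_+_ (F (f 0))) (∑-applyUpTo F (f ∘ suc) n)

sumUpTo-cong : ∀ n {f g : ℕ → ℕ} → (∀ j → j < n → f j ≡ g j) → sumUpTo n f ≡ sumUpTo n g
sumUpTo-cong zero    e = refl
sumUpTo-cong (suc n) e = cong₂ _+_ (e 0 (s≤s z≤n)) (sumUpTo-cong n (λ j j<n → e (suc j) (s≤s j<n)))

sumUpTo-+ : ∀ n (f g : ℕ → ℕ) → sumUpTo n (λ j → f j + g j) ≡ sumUpTo n f + sumUpTo n g
sumUpTo-+ zero    f g = refl
sumUpTo-+ (suc n) f g =
  trans (cong (_+_ (f 0 + g 0)) (sumUpTo-+ n (f ∘ suc) (g ∘ suc)))
        (interchange (f 0) (g 0) (sumUpTo n (f ∘ suc)) (sumUpTo n (g ∘ suc)))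

sumUpTo-++ : ∀ m n (f : ℕ → ℕ) → sumUpTo (m + n) f ≡ sumUpTo m f + sumUpTo n (λ j → f (m + j))
sumUpTo-++ zero    n f = refl
sumUpTo-++ (suc m) n f = trans (cong (_+_ (f 0)) (sumUpTo-++ m n (f ∘ suc))) (sym (ℕ.+-assoc (f 0) _ _))

sumUpTo-suc : ∀ n (f : ℕ → ℕ) → sumUpTo (suc n) f ≡ sumUpTo n f + f n
sumUpTo-suc zero    f = ℕ.+-identityʳ (f 0)
sumUpTo-suc (suc n) f = trans (cong (_+_ (f 0)) (sumUpTo-suc n (f ∘ suc))) (sym (ℕ.+-assoc (f 0) _ _))

sumUpTo-double : ∀ n (f : ℕ → ℕ) → sumUpTo (n + n) f ≡ sumUpTo n (λ c → f (c + c) + f (suc (c + c)))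
sumUpTo-double zero    f = refl
sumUpTo-double (suc n) f = begin
  f 0 + sumUpTo (n + suc n) (f ∘ suc)
    ≡⟨ cong (λ k → f 0 + sumUpTo k (f ∘ suc)) (ℕ.+-suc n n) ⟩
  f 0 + (f 1 + sumUpTo (n + n) (f ∘ suc ∘ suc))
    ≡⟨ sym (ℕ.+-assoc (f 0) (f 1) _) ⟩
  f 0 + f 1 + sumUpTo (n + n) (f ∘ suc ∘ suc)
    ≡⟨ cong (_+_ (f 0 + f 1)) (sumUpTo-double n (f ∘ suc ∘ suc)) ⟩
  f 0 + f 1 + sumUpTo n (λ c → f (suc (suc (c + c))) + f (suc (suc (suc (c + c)))))
    ≡⟨ cong (_+_ (f 0 + f 1))
            (sumUpTo-cong n (λ c _ → cong (λ k → f k + f (suc k)) (sym (ℕ.+-suc (suc c) c)))) ⟩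
  f 0 + f 1 + sumUpTo n (λ c → f (suc c + suc c) + f (suc (suc c + suc c))) ∎
  where open ≡-Reasoning
sumUpTo-insert : ∀ {n k} (f g : ℕ → ℕ) → k ≤ n →
                 (∀ c → c < k → g c ≡ f c) → (∀ c → k ≤ c → g c ≡ f (suc c)) →
                 sumUpTo (suc n) f ≡ sumUpTo n g + f k
sumUpTo-insert {n} f g z≤n _ above =
  trans (ℕ.+-comm (f 0) _) (cong (λ s → s + f 0) (sym (sumUpTo-cong n (λ c _ → above c z≤n))))
sumUpTo-insert {suc n} f g (s≤s k≤n) below above = begin
  f 0 + sumUpTo (suc n) (f ∘ suc)
    ≡⟨ cong₂ _+_ (sym (below 0 (s≤s z≤n)))
                 (sumUpTo-insert (f ∘ suc) (g ∘ suc) k≤n (λ c c<k → below (suc c) (s≤s c<k))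
                                                       (λ c k≤c → above (suc c) (s≤s k≤c))) ⟩
  g 0 + (sumUpTo n (g ∘ suc) + f (suc _))
    ≡⟨ sym (ℕ.+-assoc (g 0) _ _) ⟩
  g 0 + sumUpTo n (g ∘ suc) + f (suc _) ∎
  where open ≡-Reasoning

sumUpTo-update : ∀ n {c₀} (f g : ℕ → ℕ) → c₀ < n → (∀ c → c ≢ c₀ → f c ≡ g c) →
                 sumUpTo n f + g c₀ ≡ sumUpTo n g + f c₀
sumUpTo-update (suc n) {zero} f g _ agree =
  trans (xy∙z≈zy∙x (f 0) _ (g 0)) (cong (λ s → g 0 + s + f 0) (sumUpTo-cong n (λ j _ → agree (suc j) (λ ()))))
sumUpTo-update (suc n) {suc c₀} f g (s≤s c₀<n) agree = begin
  f 0 + sumUpTo n (f ∘ suc) + g (suc c₀)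
    ≡⟨ ℕ.+-assoc (f 0) _ _ ⟩
  f 0 + (sumUpTo n (f ∘ suc) + g (suc c₀))
    ≡⟨ cong₂ _+_ (agree 0 (λ ()))
                 (sumUpTo-update n (f ∘ suc) (g ∘ suc) c₀<n
                                 (λ c c≢c₀ → agree (suc c) (c≢c₀ ∘ ℕ.suc-injective))) ⟩
  g 0 + (sumUpTo n (g ∘ suc) + f (suc c₀))
    ≡⟨ sym (ℕ.+-assoc (g 0) _ _) ⟩
  g 0 + sumUpTo n (g ∘ suc) + f (suc c₀) ∎
  where open ≡-Reasoning

+-cross : ∀ {a b c d} → a ≡ d → b ≡ c → a + b ≡ c + d
+-cross {a} {b} refl refl = ℕ.+-comm a b

bit : Bool → ℕ
bit b = if b then 1 else 0

bit≤1 : ∀ b → bit b ≤ 1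
bit≤1 true  = s≤s z≤n
bit≤1 false = z≤n

⌊⌋-true : {P : Set} (P? : Dec P) → P → ⌊ P? ⌋ ≡ true
⌊⌋-true P? p = trans (isYes≗does P?) (dec-true P? p)

⌊⌋-false : {P : Set} (P? : Dec P) → ¬ P → ⌊ P? ⌋ ≡ false
⌊⌋-false P? ¬p = trans (isYes≗does P?) (dec-false P? ¬p)

⌊⌋-⇔ : {P Q : Set} (P? : Dec P) (Q? : Dec Q) → (P → Q) → (Q → P) → ⌊ P? ⌋ ≡ ⌊ Q? ⌋
⌊⌋-⇔ P? Q? P→Q Q→P = trans (isYes≗does P?) (trans (does-⇔ (mk⇔ P→Q Q→P) P? Q?) (sym (isYes≗does Q?)))

ltBit : ℕ → ℕ → ℕ
ltBit a c = bit ⌊ a ℕ.<? c ⌋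

ltBit-≥ : ∀ {a c} → c ≤ a → ltBit a c ≡ 0
ltBit-≥ {a} {c} c≤a = cong bit (⌊⌋-false (a ℕ.<? c) (ℕ.≤⇒≯ c≤a))

ltBit-< : ∀ {a c} → a < c → ltBit a c ≡ 1
ltBit-< {a} {c} a<c = cong bit (⌊⌋-true (a ℕ.<? c) a<c)

+-ltBit-≥ : ∀ {a c} → c ≤ a → a + ltBit a c ≡ a
+-ltBit-≥ c≤a = trans (cong (_+_ _) (ltBit-≥ c≤a)) (ℕ.+-identityʳ _)

+-ltBit-< : ∀ {a c} → a < c → a + ltBit a c ≡ suc a
+-ltBit-< {a} a<c = trans (cong (_+_ a) (ltBit-< a<c)) (ℕ.+-comm a 1)

ltBit-+bit : ∀ D b → ltBit D (D + bit b) ≡ bit b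
ltBit-+bit D false = ltBit-≥ (ℕ.≤-reflexive (ℕ.+-identityʳ D))
ltBit-+bit D true  = ltBit-< (ℕ.≤-reflexive (ℕ.+-comm 1 D))

majFrom-suc : ∀ i l → majFrom (suc i) l ≡ majFrom i l + desA l
majFrom-suc i []          = refl
majFrom-suc i (x ∷ [])    = refl
majFrom-suc i (x ∷ y ∷ r) = step ⌊ y ℤ.<? x ⌋ (majFrom-suc (suc i) (y ∷ r))
  where
  step : ∀ b {m m′ d} → m′ ≡ m + d →
         (if b then suc i else 0) + m′ ≡ ((if b then i else 0) + m) + (bit b + d)
  step true  refl = shuffle i _ _
    where
    shuffle : ∀ i m d → suc i + (m + d) ≡ i + m + (1 + d)
    shuffle = solve-∀
  step false refl = refl

majA-∷ : ∀ x y r → majA (x ∷ y ∷ r) ≡ bit ⌊ y ℤ.<? x ⌋ + (majA (y ∷ r) + desA (y ∷ r))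
majA-∷ x y r = cong (_+_ (bit ⌊ y ℤ.<? x ⌋)) (majFrom-suc 1 (y ∷ r))

desA-≤ : ∀ x r → desA (x ∷ r) ≤ length r
desA-≤ x []      = z≤n
desA-≤ x (y ∷ r) = ℕ.+-mono-≤ (bit≤1 ⌊ y ℤ.<? x ⌋) (desA-≤ y r)

neg-insertAll : ∀ z v → All (λ y → neg y ≡ neg (z ∷ v)) (insertAll z v)
neg-insertAll z []      = refl ∷ []
neg-insertAll z (y ∷ v) =
  refl ∷ All.map⁺ (All.map (λ e → trans (cong (_+_ y<0) e) (x∙yz≈y∙xz y<0 z<0 (neg v))) (neg-insertAll z v))
  where
  y<0 z<0 : ℕ
  y<0 = bit ⌊ y ℤ.<? + 0 ⌋
  z<0 = bit ⌊ z ℤ.<? + 0 ⌋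

-- The insertion lemma for (majA, desA)

-- Prepending x₀ to the insertions of z into x₁ ∷ r gives all insertions into x₀ ∷ x₁ ∷ r
-- except z ∷ x₀ ∷ x₁ ∷ r, but evaluates x₀ ∷ z ∷ x₁ ∷ r as if z were x₁.  The two correct
-- values trade for that wrong one plus the single new term c = desA (x₁ ∷ r) + 1.
insert-around-head : (K : ℕ → ℕ → ℕ) (z x₀ x₁ : ℤ) (r : List ℤ) → x₀ ≢ z →
  let v = x₁ ∷ r ; α = bit ⌊ x₁ ℤ.<? x₀ ⌋ ; D = desA v ; D₀ = desA (x₀ ∷ v) in
  K (majA (z ∷ x₀ ∷ v)) (desA (z ∷ x₀ ∷ v)) + K (majA (x₀ ∷ z ∷ v)) (desA (x₀ ∷ z ∷ v))
  ≡ K (α + (majA (z ∷ v) + desA (z ∷ v))) (α + desA (z ∷ v))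
    + K (majA (x₀ ∷ v) + suc D) (D₀ + ltBit D₀ (suc D))
insert-around-head K z x₀ x₁ r x₀≢z
  rewrite majA-∷ z x₀ (x₁ ∷ r) | majA-∷ x₀ x₁ r | majA-∷ x₀ z (x₁ ∷ r) | majA-∷ z x₁ r
  with x₁ ℤ.<? x₀ | x₀ ℤ.<? z | z ℤ.<? x₀ | x₁ ℤ.<? z
... | _     | yes p | yes q | _     = ⊥-elim (ℤ.<-asym p q)
... | _     | no p  | no q  | _     = ⊥-elim (x₀≢z (ℤ.≤-antisym (ℤ.≮⇒≥ q) (ℤ.≮⇒≥ p)))
... | yes p | yes q | no _  | no r  = ⊥-elim (r (ℤ.<-trans p q))
... | no p  | no _  | yes q | yes r = ⊥-elim (p (ℤ.<-trans r q))
... | yes _ | yes _ | no _  | yes _ =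
  cong₂ _+_ refl (cong₂ K refl (sym (+-ltBit-≥ {suc (desA (x₁ ∷ r))} ℕ.≤-refl)))
... | yes _ | no _  | yes _ | _     =
  +-cross (cong₂ K refl (sym (+-ltBit-≥ {suc (desA (x₁ ∷ r))} ℕ.≤-refl))) refl
... | no _  | yes _ | no _  | _     =
  +-cross (cong₂ K (sym (ℕ.+-suc _ _)) (sym (+-ltBit-< {desA (x₁ ∷ r)} ℕ.≤-refl))) refl
... | no _  | no _  | yes _ | no _  =
  cong₂ _+_ refl (cong₂ K (sym (ℕ.+-suc _ _)) (sym (+-ltBit-< {desA (x₁ ∷ r)} ℕ.≤-refl)))

insertAll-majA-desA : ∀ z v → All (_≢ z) v → (K : ℕ → ℕ → ℕ) →
  ∑ (λ y → K (majA y) (desA y)) (insertAll z v) ≡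
  sumUpTo (suc (length v)) (λ c → K (majA v + c) (desA v + ltBit (desA v) c))
insertAll-majA-desA z []       _          K = refl
insertAll-majA-desA z (x ∷ []) (x≢z ∷ []) K with x ℤ.<? z | z ℤ.<? x
... | yes x<z | yes z<x = ⊥-elim (ℤ.<-asym x<z z<x)
... | yes _   | no _    = x∙yz≈y∙xz (K 1 1) (K 0 0) 0
... | no _    | yes _   = refl
... | no x≮z  | no z≮x  = ⊥-elim (x≢z (ℤ.≤-antisym (ℤ.≮⇒≥ z≮x) (ℤ.≮⇒≥ x≮z)))
insertAll-majA-desA z (x₀ ∷ x₁ ∷ r) (x₀≢z ∷ v≢z) K = begin
  w (z ∷ x₀ ∷ v) + (w (x₀ ∷ z ∷ v) + ∑ w (map (x₀ ∷_) (map (x₁ ∷_) (insertAll z r))))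
    ≡⟨ sym (ℕ.+-assoc (w (z ∷ x₀ ∷ v)) (w (x₀ ∷ z ∷ v)) _) ⟩
  w (z ∷ x₀ ∷ v) + w (x₀ ∷ z ∷ v) + ∑ w (map (x₀ ∷_) (map (x₁ ∷_) (insertAll z r)))
    ≡⟨ cong₂ _+_ (insert-around-head K z x₀ x₁ r x₀≢z) (behind-x₁ (insertAll z r)) ⟩
  w′ (z ∷ v) + F (suc D) + ∑ w′ (map (x₁ ∷_) (insertAll z r))
    ≡⟨ xy∙z≈xz∙y (w′ (z ∷ v)) (F (suc D)) _ ⟩
  ∑ w′ (insertAll z v) + F (suc D)
    ≡⟨ cong (λ s → s + F (suc D)) (insertAll-majA-desA z v v≢z K′) ⟩
  sumUpTo (suc (length v)) G + F (suc D)
    ≡⟨ sym (sumUpTo-insert F G (s≤s (ℕ.m≤n⇒m≤1+n (desA-≤ x₁ r))) below above) ⟩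
  sumUpTo (suc (length (x₀ ∷ v))) F ∎
  where
  open ≡-Reasoning
  v : List ℤ
  v = x₁ ∷ r
  α M D : ℕ
  α = bit ⌊ x₁ ℤ.<? x₀ ⌋
  M = majA v
  D = desA v

  w w′ : List ℤ → ℕ
  w y = K (majA y) (desA y)
  K′ : ℕ → ℕ → ℕ
  K′ m d = K (α + (m + d)) (α + d)
  w′ y = K′ (majA y) (desA y)

  F G : ℕ → ℕ
  F c = K (majA (x₀ ∷ v) + c) (desA (x₀ ∷ v) + ltBit (desA (x₀ ∷ v)) c)
  G c = K′ (M + c) (D + ltBit D c)

  behind-x₁ : ∀ L → ∑ w (map (x₀ ∷_) (map (x₁ ∷_) L)) ≡ ∑ w′ (map (x₁ ∷_) L)
  behind-x₁ L = begin
    ∑ w (map (x₀ ∷_) (map (x₁ ∷_) L))    ≡⟨ ∑-map w (x₀ ∷_) (map (x₁ ∷_) L) ⟩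
    ∑ (w ∘ (x₀ ∷_)) (map (x₁ ∷_) L)      ≡⟨ ∑-map _ (x₁ ∷_) L ⟩
    ∑ (λ y → w (x₀ ∷ x₁ ∷ y)) L
      ≡⟨ ∑-cong (λ y → cong (λ m → K m (desA (x₀ ∷ x₁ ∷ y))) (majA-∷ x₀ x₁ y)) L ⟩
    ∑ (λ y → w′ (x₁ ∷ y)) L               ≡⟨ sym (∑-map w′ (x₁ ∷_) L) ⟩
    ∑ w′ (map (x₁ ∷_) L)                  ∎

  below : ∀ c → c < suc D → G c ≡ F c
  below c (s≤s c≤D) rewrite majA-∷ x₀ x₁ r | ltBit-≥ c≤D
                          | ltBit-≥ (ℕ.≤-trans c≤D (ℕ.m≤n+m D α)) =
    cong₂ K (shuffle α M c D) (sym (ℕ.+-assoc α D 0))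
    where
    shuffle : ∀ α M c D → α + ((M + c) + (D + 0)) ≡ α + (M + D) + c
    shuffle = solve-∀

  above : ∀ c → suc D ≤ c → G c ≡ F (suc c)
  above c D<c rewrite majA-∷ x₀ x₁ r | ltBit-< D<c
                    | ltBit-< {α + D} (s≤s (ℕ.≤-trans (ℕ.+-monoˡ-≤ D (bit≤1 ⌊ x₁ ℤ.<? x₀ ⌋)) D<c)) =
    cong₂ K (shuffle α M c D) (sym (ℕ.+-assoc α D 1))
    where
    shuffle : ∀ α M c D → α + ((M + c) + (D + 1)) ≡ α + (M + D) + suc c
    shuffle = solve-∀

-- Inserting ±1 into a signed permutation

-- Away from the front, inserting z keeps ε₁ and shifts neg uniformly, so fmaj and fdes
-- follow majA and desA through the insertion lemma.  At the front ε₁ changes; what the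
-- lemma predicts there is its term φ (desA w + ε₁ w), which is exchanged for the true value.
insertAll-fmaj-fdes : (F : ℕ → ℕ → ℕ) (z x : ℤ) (r : List ℤ) → All (_≢ z) (x ∷ r) →
  ⌊ x ℤ.<? z ⌋ ≡ ⌊ x ℤ.<? + 0 ⌋ →
  let w = x ∷ r ; e = ε₁ w ; D = desA w
      φ = λ c → F (2 * (majA w + c) + neg (z ∷ w)) (2 * (D + ltBit D c) + e)
  in ∑ (λ y → F (fmaj y) (fdes y)) (insertAll z w) + φ (D + e)
     ≡ F (fmaj (z ∷ w)) (fdes (z ∷ w)) + sumUpTo (suc (length w)) φ
insertAll-fmaj-fdes F z x r w≢z x<z≡x<0 = begin
  actual (z ∷ w) + ∑ actual (map (x ∷_) (insertAll z r)) + φ c₀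
    ≡⟨ ℕ.+-assoc (actual (z ∷ w)) _ _ ⟩
  actual (z ∷ w) + (∑ actual (map (x ∷_) (insertAll z r)) + φ c₀)
    ≡⟨ cong (_+_ (actual (z ∷ w))) (cong₂ _+_ behind-x in-front) ⟩
  actual (z ∷ w) + (∑ predicted (map (x ∷_) (insertAll z r)) + predicted (z ∷ w))
    ≡⟨ cong (_+_ (actual (z ∷ w))) (ℕ.+-comm _ (predicted (z ∷ w))) ⟩
  actual (z ∷ w) + ∑ predicted (insertAll z w)
    ≡⟨ cong (_+_ (actual (z ∷ w))) (insertAll-majA-desA z w w≢z K) ⟩
  actual (z ∷ w) + sumUpTo (suc (length w)) φ ∎
  where
  open ≡-Reasoning
  w : List ℤ
  w = x ∷ r
  e M D c₀ : ℕ
  e = ε₁ w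
  M = majA w
  D = desA w
  c₀ = D + e

  K : ℕ → ℕ → ℕ
  K m d = F (2 * m + neg (z ∷ w)) (2 * d + e)

  actual predicted : List ℤ → ℕ
  actual y = F (fmaj y) (fdes y)
  predicted y = K (majA y) (desA y)

  φ : ℕ → ℕ
  φ c = K (M + c) (D + ltBit D c)

  behind-x : ∑ actual (map (x ∷_) (insertAll z r)) ≡ ∑ predicted (map (x ∷_) (insertAll z r))
  behind-x = ∑-cong-local (All.map⁺ (All.map (λ {t} → cong (λ n → F (2 * majA (x ∷ t) + n) (fdes (x ∷ t))))
                                             (All.map⁻ (All.tail (neg-insertAll z w)))))

  in-front : φ c₀ ≡ predicted (z ∷ w)
  in-front = cong₂ K
    (begin
      M + (D + e)                  ≡⟨ x∙yz≈z∙xy M D e ⟩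
      e + (M + D)                  ≡⟨ cong (λ b → bit b + (M + D)) (sym x<z≡x<0) ⟩
      bit ⌊ x ℤ.<? z ⌋ + (M + D)    ≡⟨ sym (majA-∷ z x r) ⟩
      majA (z ∷ w)                 ∎)
    (begin
      D + ltBit D (D + e)          ≡⟨ cong (_+_ D) (ltBit-+bit D ⌊ x ℤ.<? + 0 ⌋) ⟩
      D + e                        ≡⟨ ℕ.+-comm D e ⟩
      e + D                        ≡⟨ cong (λ b → bit b + D) (sym x<z≡x<0) ⟩
      desA (z ∷ w)                 ∎)

-- The increase of fdes B at the j-th signed insertion, counted in order of increasing fmaj.
fdesJump : ℕ → ℕ → ℕ
fdesJump B j = ltBit B j + ltBit (suc B) j

fdesJump-≤ : ∀ {B j} → j ≤ B → fdesJump B j ≡ 0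
fdesJump-≤ j≤B = cong₂ _+_ (ltBit-≥ j≤B) (ltBit-≥ (ℕ.m≤n⇒m≤1+n j≤B))

fdesJump-suc : ∀ B → fdesJump B (suc B) ≡ 1
fdesJump-suc B = cong₂ _+_ (ltBit-< (ℕ.≤-refl {suc B})) (ltBit-≥ (ℕ.≤-refl {suc B}))

fdesJump-≥ : ∀ {B j} → suc (suc B) ≤ j → fdesJump B j ≡ 2
fdesJump-≥ 2+B≤j = cong₂ _+_ (ltBit-< (ℕ.<⇒≤ 2+B≤j)) (ltBit-< 2+B≤j)

2*D+e≡e+[D+D] : ∀ D e → 2 * D + e ≡ e + (D + D)
2*D+e≡e+[D+D] = solve-∀

fdesJump-pair : ∀ b p {c D} → c ≢ D + bit b →
                fdesJump (2 * D + bit b) (bit p + (c + c)) ≡ 2 * ltBit D c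
fdesJump-pair b p {c} {D} c≢D+b rewrite 2*D+e≡e+[D+D] D (bit b) with ℕ.<-cmp c D
... | tri< c<D _ _ = trans (fdesJump-≤ below) (cong (2 *_) (sym (ltBit-≥ (ℕ.<⇒≤ c<D))))
  where
  open ℕ.≤-Reasoning
  below : bit p + (c + c) ≤ bit b + (D + D)
  below = begin
    bit p + (c + c)   ≤⟨ ℕ.+-monoˡ-≤ (c + c) (bit≤1 p) ⟩
    suc (c + c)       ≤⟨ s≤s (ℕ.+-monoʳ-≤ c (ℕ.n≤1+n c)) ⟩
    suc c + suc c     ≤⟨ ℕ.+-mono-≤ c<D c<D ⟩
    D + D             ≤⟨ ℕ.m≤n+m (D + D) (bit b) ⟩
    bit b + (D + D)   ∎
... | tri≈ _ refl _ with b
...   | false = ⊥-elim (c≢D+b (sym (ℕ.+-identityʳ c)))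
...   | true  =
  trans (fdesJump-≤ (ℕ.+-monoˡ-≤ (c + c) (bit≤1 p))) (cong (2 *_) (sym (ltBit-≥ (ℕ.≤-refl {c}))))
fdesJump-pair b p {c} {D} c≢D+b | tri> _ _ D<c = trans (fdesJump-≥ (above b c≢D+b)) (cong (2 *_) (sym (ltBit-< D<c)))
  where
  open ℕ.≤-Reasoning
  above : ∀ b → c ≢ D + bit b → suc (suc (bit b + (D + D))) ≤ bit p + (c + c)
  above false _ = begin
    suc (suc (D + D))   ≡⟨ cong suc (sym (ℕ.+-suc D D)) ⟩
    suc D + suc D       ≤⟨ ℕ.+-mono-≤ D<c D<c ⟩
    c + c               ≤⟨ ℕ.m≤n+m (c + c) (bit p) ⟩
    bit p + (c + c)     ∎
  above true c≢D+1 = begin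
    suc (suc (suc (D + D)))   ≡⟨ cong (suc ∘ suc) (sym (ℕ.+-suc D D)) ⟩
    suc (suc D) + suc D       ≤⟨ ℕ.+-mono-≤ D+1<c (ℕ.<⇒≤ D+1<c) ⟩
    c + c                     ≤⟨ ℕ.m≤n+m (c + c) (bit p) ⟩
    bit p + (c + c)           ∎
    where
    D+1<c : suc D < c
    D+1<c = ℕ.≤∧≢⇒< D<c (λ D+1≡c → c≢D+1 (trans (sym D+1≡c) (ℕ.+-comm 1 D)))

fdesJump-even-at : ∀ b D → fdesJump (2 * D + bit b) ((D + bit b) + (D + bit b)) ≡ bit b
fdesJump-even-at b D rewrite 2*D+e≡e+[D+D] D (bit b) with b
... | false rewrite ℕ.+-identityʳ D = fdesJump-≤ {D + D} ℕ.≤-refl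
... | true  rewrite ℕ.+-comm D 1 | ℕ.+-suc D D = fdesJump-suc (suc (D + D))

fdesJump-odd-at : ∀ b D → fdesJump (2 * D + bit b) (suc ((D + bit b) + (D + bit b))) ≡ suc (bit b)
fdesJump-odd-at b D rewrite 2*D+e≡e+[D+D] D (bit b) with b
... | false rewrite ℕ.+-identityʳ D = fdesJump-suc (D + D)
... | true  rewrite ℕ.+-comm D 1 | ℕ.+-suc D D = fdesJump-≥ {suc (D + D)} ℕ.≤-refl

<+1≡<0 : ∀ {x} → 2 ≤ ℤ.∣ x ∣ → ⌊ x ℤ.<? + 1 ⌋ ≡ ⌊ x ℤ.<? + 0 ⌋
<+1≡<0 {+ suc (suc n)} _ = refl
<+1≡<0 { -[1+ suc n ] } _ = refl
<+1≡<0 {+ 1}      (s≤s ())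
<+1≡<0 { -[1+ 0 ] } (s≤s ())

<-1≡<0 : ∀ {x} → 2 ≤ ℤ.∣ x ∣ → ⌊ x ℤ.<? - (+ 1) ⌋ ≡ ⌊ x ℤ.<? + 0 ⌋
<-1≡<0 {+ suc (suc n)} _ = refl
<-1≡<0 { -[1+ suc n ] } _ = refl
<-1≡<0 {+ 1}      (s≤s ())
<-1≡<0 { -[1+ 0 ] } (s≤s ())

≢+1 : ∀ {x} → 2 ≤ ℤ.∣ x ∣ → x ≢ + 1
≢+1 (s≤s ()) refl

≢-1 : ∀ {x} → 2 ≤ ℤ.∣ x ∣ → x ≢ - (+ 1)
≢-1 (s≤s ()) refl

insertSigned : ℕ → List ℤ → List (List ℤ)
insertSigned k s = insertAll (+ k) s ++ insertAll (- (+ k)) s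

jump-pair : (F : ℕ → ℕ → ℕ) (M N D : ℕ) (b : Bool) {c : ℕ} → c ≢ D + bit b →
  let fd = 2 * D + bit b ; Φ = λ j → F (2 * M + N + j) (fd + fdesJump fd j) in
  Φ (c + c) + Φ (suc (c + c))
  ≡ F (2 * (M + c) + N) (2 * (D + ltBit D c) + bit b) + F (2 * (M + c) + suc N) (2 * (D + ltBit D c) + bit b)
jump-pair F M N D b {c} c≢D+b = cong₂ _+_
  (cong₂ F (even M N c) (trans (cong (_+_ fd) (fdesJump-pair b false c≢D+b)) (collect D (bit b) (ltBit D c))))
  (cong₂ F (odd M N c)  (trans (cong (_+_ fd) (fdesJump-pair b true c≢D+b)) (collect D (bit b) (ltBit D c))))
  where
  fd : ℕ
  fd = 2 * D + bit b
  even : ∀ M N c → 2 * M + N + (c + c) ≡ 2 * (M + c) + N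
  even = solve-∀
  odd : ∀ M N c → 2 * M + N + suc (c + c) ≡ 2 * (M + c) + suc N
  odd = solve-∀
  collect : ∀ D e l → 2 * D + e + 2 * l ≡ 2 * (D + l) + e
  collect = solve-∀

front-pair : (F : ℕ → ℕ → ℕ) (x : ℤ) (r : List ℤ) → 2 ≤ ℤ.∣ x ∣ →
  let w = x ∷ r ; c₀ = desA w + ε₁ w ; fd = fdes w ; Φ = λ j → F (fmaj w + j) (fd + fdesJump fd j) in
  F (fmaj (+ 1 ∷ w)) (fdes (+ 1 ∷ w)) + F (fmaj (- (+ 1) ∷ w)) (fdes (- (+ 1) ∷ w))
  ≡ Φ (c₀ + c₀) + Φ (suc (c₀ + c₀))
front-pair F x r x≥2 = trans (cong₂ _+_ (front (+ 1) (<+1≡<0 x≥2)) (front (- (+ 1)) (<-1≡<0 x≥2)))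
  (cong₂ _+_ (cong₂ F (even M N D e) (sym (trans (cong (_+_ fd) (fdesJump-even-at b D)) (even′ D e))))
             (cong₂ F (odd M N D e)  (sym (trans (cong (_+_ fd) (fdesJump-odd-at b D)) (odd′ D e)))))
  where
  w : List ℤ
  w = x ∷ r
  b : Bool
  b = ⌊ x ℤ.<? + 0 ⌋
  e M D N fd : ℕ
  e = bit b
  M = majA w
  D = desA w
  N = neg w
  fd = fdes w

  front : ∀ z → ⌊ x ℤ.<? z ⌋ ≡ b →
          F (fmaj (z ∷ w)) (fdes (z ∷ w)) ≡ F (2 * (e + (M + D)) + neg (z ∷ w)) (2 * (e + D) + ε₁ [ z ])
  front z x<z≡b = cong₂ F
    (cong (λ m → 2 * m + neg (z ∷ w)) (trans (majA-∷ z x r) (cong (λ β → bit β + (M + D)) x<z≡b)))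
    (cong (λ β → 2 * (bit β + D) + ε₁ [ z ]) x<z≡b)

  even : ∀ M N D e → 2 * (e + (M + D)) + N ≡ 2 * M + N + ((D + e) + (D + e))
  even = solve-∀
  odd : ∀ M N D e → 2 * (e + (M + D)) + suc N ≡ 2 * M + N + suc ((D + e) + (D + e))
  odd = solve-∀
  even′ : ∀ D e → 2 * D + e + e ≡ 2 * (e + D) + 0
  even′ = solve-∀
  odd′ : ∀ D e → 2 * D + e + suc e ≡ 2 * (e + D) + 1
  odd′ = solve-∀

-- Positions 2c and 2c+1 on the right correspond to inserting +1 and -1 in position c;
-- this matches except at c₀ = desA + ε₁, which is where the two front insertions land.
insertSigned-fmaj-fdes : (F : ℕ → ℕ → ℕ) (w : List ℤ) → All (λ x → 2 ≤ ℤ.∣ x ∣) w →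
  ∑ (λ y → F (fmaj y) (fdes y)) (insertSigned 1 w)
  ≡ sumUpTo (suc (length w) + suc (length w)) (λ j → F (fmaj w + j) (fdes w + fdesJump (fdes w) j))
insertSigned-fmaj-fdes F []      []              = refl
insertSigned-fmaj-fdes F (x ∷ r) w≥2@(x≥2 ∷ _) = ℕ.+-cancelʳ-≡ (φ c₀) _ _ (begin
  ∑ actual (insertAll (+ 1) w ++ insertAll (- (+ 1)) w) + (φ₊ c₀ + φ₋ c₀)
    ≡⟨ cong (λ t → t + φ c₀) (∑-++ actual (insertAll (+ 1) w) (insertAll (- (+ 1)) w)) ⟩
  ∑ actual (insertAll (+ 1) w) + ∑ actual (insertAll (- (+ 1)) w) + (φ₊ c₀ + φ₋ c₀)
    ≡⟨ interchange (∑ actual (insertAll (+ 1) w)) _ (φ₊ c₀) (φ₋ c₀) ⟩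
  (∑ actual (insertAll (+ 1) w) + φ₊ c₀) + (∑ actual (insertAll (- (+ 1)) w) + φ₋ c₀)
    ≡⟨ cong₂ _+_ (insertAll-fmaj-fdes F (+ 1) x r (All.map ≢+1 w≥2) (<+1≡<0 x≥2))
                 (insertAll-fmaj-fdes F (- (+ 1)) x r (All.map ≢-1 w≥2) (<-1≡<0 x≥2)) ⟩
  (actual (+ 1 ∷ w) + sumUpTo s φ₊) + (actual (- (+ 1) ∷ w) + sumUpTo s φ₋)
    ≡⟨ interchange (actual (+ 1 ∷ w)) _ _ _ ⟩
  (actual (+ 1 ∷ w) + actual (- (+ 1) ∷ w)) + (sumUpTo s φ₊ + sumUpTo s φ₋)
    ≡⟨ cong₂ _+_ (front-pair F x r x≥2) (sym (sumUpTo-+ s φ₊ φ₋)) ⟩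
  ψ c₀ + sumUpTo s φ
    ≡⟨ ℕ.+-comm (ψ c₀) _ ⟩
  sumUpTo s φ + ψ c₀
    ≡⟨ sumUpTo-update s ψ φ c₀<s (λ c c≢c₀ → jump-pair F M N D b c≢c₀) ⟨
  sumUpTo s ψ + φ c₀
    ≡⟨ cong (λ t → t + φ c₀) (sumUpTo-double s Φ) ⟨
  sumUpTo (s + s) Φ + φ c₀ ∎)
  where
  open ≡-Reasoning
  w : List ℤ
  w = x ∷ r
  b : Bool
  b = ⌊ x ℤ.<? + 0 ⌋
  M D N s c₀ : ℕ
  M = majA w
  D = desA w
  N = neg w
  s = suc (length w)
  c₀ = D + bit b

  actual : List ℤ → ℕ
  actual y = F (fmaj y) (fdes y)

  Φ ψ φ₊ φ₋ φ : ℕ → ℕ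
  Φ j = F (fmaj w + j) (fdes w + fdesJump (fdes w) j)
  ψ c = Φ (c + c) + Φ (suc (c + c))
  φ₊ c = F (2 * (M + c) + N) (2 * (D + ltBit D c) + bit b)
  φ₋ c = F (2 * (M + c) + suc N) (2 * (D + ltBit D c) + bit b)
  φ c = φ₊ c + φ₋ c

  c₀<s : c₀ < s
  c₀<s = s≤s (ℕ.≤-trans (ℕ.+-mono-≤ (desA-≤ x r) (bit≤1 b)) (ℕ.≤-reflexive (ℕ.+-comm (length r) 1)))

-- Makes room for ±1 in the window of a signed permutation; sucAbs (+ 0) = + 1 is junk.
sucAbs : ℤ → ℤ
sucAbs (+ n)    = + suc n
sucAbs -[1+ n ] = -[1+ suc n ]

sucAbs-<⁺ : ∀ {x y} → x ℤ.< y → sucAbs x ℤ.< sucAbs y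
sucAbs-<⁺ (ℤ.-<- n<m) = ℤ.-<- (s≤s n<m)
sucAbs-<⁺ ℤ.-<+       = ℤ.-<+
sucAbs-<⁺ (ℤ.+<+ m<n) = ℤ.+<+ (s≤s m<n)

sucAbs-<⁻ : ∀ x y → sucAbs x ℤ.< sucAbs y → x ℤ.< y
sucAbs-<⁻ (+ m)    (+ n)    (ℤ.+<+ (s≤s m<n)) = ℤ.+<+ m<n
sucAbs-<⁻ -[1+ m ] (+ n)    _                 = ℤ.-<+
sucAbs-<⁻ -[1+ m ] -[1+ n ] (ℤ.-<- (s≤s n<m)) = ℤ.-<- n<m

sucAbs-< : ∀ x y → ⌊ sucAbs x ℤ.<? sucAbs y ⌋ ≡ ⌊ x ℤ.<? y ⌋
sucAbs-< x y = ⌊⌋-⇔ (sucAbs x ℤ.<? sucAbs y) (x ℤ.<? y) (sucAbs-<⁻ x y) sucAbs-<⁺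

sucAbs-<0 : ∀ x → ⌊ sucAbs x ℤ.<? + 0 ⌋ ≡ ⌊ x ℤ.<? + 0 ⌋
sucAbs-<0 (+ n)    = refl
sucAbs-<0 -[1+ n ] = refl

majFrom-sucAbs : ∀ i l → majFrom i (map sucAbs l) ≡ majFrom i l
majFrom-sucAbs i []          = refl
majFrom-sucAbs i (x ∷ [])    = refl
majFrom-sucAbs i (x ∷ y ∷ r) =
  cong₂ (λ b m → (if b then i else 0) + m) (sucAbs-< y x) (majFrom-sucAbs (suc i) (y ∷ r))

desA-sucAbs : ∀ l → desA (map sucAbs l) ≡ desA l
desA-sucAbs []          = refl
desA-sucAbs (x ∷ [])    = refl
desA-sucAbs (x ∷ y ∷ r) = cong₂ (λ b d → bit b + d) (sucAbs-< y x) (desA-sucAbs (y ∷ r))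

neg-sucAbs : ∀ l → neg (map sucAbs l) ≡ neg l
neg-sucAbs []      = refl
neg-sucAbs (x ∷ r) = cong₂ (λ b n → bit b + n) (sucAbs-<0 x) (neg-sucAbs r)

fmaj-sucAbs : ∀ l → fmaj (map sucAbs l) ≡ fmaj l
fmaj-sucAbs l = cong₂ (λ m n → 2 * m + n) (majFrom-sucAbs 1 l) (neg-sucAbs l)

fdes-sucAbs : ∀ l → fdes (map sucAbs l) ≡ fdes l
fdes-sucAbs []      = refl
fdes-sucAbs (x ∷ r) = cong₂ (λ d b → 2 * d + bit b) (desA-sucAbs (x ∷ r)) (sucAbs-<0 x)

sucAbs-≥2 : ∀ {x} → ℤ.∣ x ∣ ≢ 0 → 2 ≤ ℤ.∣ sucAbs x ∣
sucAbs-≥2 {+ zero}    ∣x∣≢0 = ⊥-elim (∣x∣≢0 refl)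
sucAbs-≥2 {+ suc n}   _     = s≤s (s≤s z≤n)
sucAbs-≥2 { -[1+ n ] } _    = s≤s (s≤s z≤n)

insertSigned-sucAbs : (F : ℕ → ℕ → ℕ) (u : List ℤ) → All (λ x → ℤ.∣ x ∣ ≢ 0) u →
  ∑ (λ y → F (fmaj y) (fdes y)) (insertSigned 1 (map sucAbs u))
  ≡ sumUpTo (suc (length u) + suc (length u)) (λ j → F (fmaj u + j) (fdes u + fdesJump (fdes u) j))
insertSigned-sucAbs F u u≢0
  with insertSigned-fmaj-fdes F (map sucAbs u) (All.map⁺ (All.map (λ {x} → sucAbs-≥2 {x}) u≢0))
... | eq rewrite List.length-map sucAbs u | fmaj-sucAbs u | fdes-sucAbs u = eq

-- B (suc m) from B m

insertAll-map : {A C : Set} (f : A → C) (x : A) (l : List A) →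
                insertAll (f x) (map f l) ≡ map (map f) (insertAll x l)
insertAll-map f x []      = refl
insertAll-map f x (y ∷ l) = cong ((f x ∷ f y ∷ map f l) ∷_) (begin
  map (f y ∷_) (insertAll (f x) (map f l))    ≡⟨ cong (map (f y ∷_)) (insertAll-map f x l) ⟩
  map (f y ∷_) (map (map f) (insertAll x l))  ≡⟨ List.map-∘ (insertAll x l) ⟨
  map (map f ∘ (y ∷_)) (insertAll x l)        ≡⟨ List.map-∘ (insertAll x l) ⟩
  map (map f) (map (y ∷_) (insertAll x l))    ∎)
  where open ≡-Reasoning

perms-map : {A C : Set} (f : A → C) (xs : List A) → perms (map f xs) ≡ map (map f) (perms xs)
perms-map f []       = refl
perms-map f (x ∷ xs) = begin
  concatMap (insertAll (f x)) (perms (map f xs))          ≡⟨ cong (concatMap _) (perms-map f xs) ⟩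
  concatMap (insertAll (f x)) (map (map f) (perms xs))    ≡⟨ List.concatMap-map _ (map f) (perms xs) ⟩
  concatMap (insertAll (f x) ∘ map f) (perms xs)          ≡⟨ List.concatMap-cong (insertAll-map f x) (perms xs) ⟩
  concatMap (map (map f) ∘ insertAll x) (perms xs)        ≡⟨ List.map-concatMap (map f) (insertAll x) (perms xs) ⟨
  map (map f) (concatMap (insertAll x) (perms xs))        ∎
  where open ≡-Reasoning

∑-perms-map : {A C : Set} (H : List C → ℕ) (f : A → C) (xs : List A) →
              ∑ H (perms (map f xs)) ≡ ∑ (H ∘ map f) (perms xs)
∑-perms-map H f xs = trans (cong (∑ H) (perms-map f xs)) (∑-map H (map f) (perms xs))

signings-map-suc : ∀ l → signings (map suc (map suc l)) ≡ map (map sucAbs) (signings (map suc l))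
signings-map-suc []      = refl
signings-map-suc (k ∷ l) = begin
  concatMap signs₂ (signings (map suc (map suc l)))          ≡⟨ cong (concatMap signs₂) (signings-map-suc l) ⟩
  concatMap signs₂ (map (map sucAbs) (signings (map suc l)))
    ≡⟨ List.concatMap-map signs₂ (map sucAbs) (signings (map suc l)) ⟩
  concatMap (map (map sucAbs) ∘ signs₁) (signings (map suc l))
    ≡⟨ List.map-concatMap (map sucAbs) signs₁ (signings (map suc l)) ⟨
  map (map sucAbs) (concatMap signs₁ (signings (map suc l))) ∎
  where
  open ≡-Reasoning
  signs₁ signs₂ : List ℤ → List (List ℤ)
  signs₁ s = (+ suc k ∷ s) ∷ (- (+ suc k) ∷ s) ∷ []
  signs₂ s = (+ suc (suc k) ∷ s) ∷ (- (+ suc (suc k)) ∷ s) ∷ []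

∑-signings-∷ : (H : List ℤ → ℕ) (y : ℕ) (l : List ℕ) →
               ∑ H (signings (y ∷ l)) ≡ ∑ (λ s → H (+ y ∷ s) + H (- (+ y) ∷ s)) (signings l)
∑-signings-∷ H y l =
  trans (∑-concatMap H _ (signings l)) (∑-cong (λ s → cong (_+_ (H (+ y ∷ s))) (ℕ.+-identityʳ _)) (signings l))

∑-insertSigned-∷ : (H : List ℤ → ℕ) (k : ℕ) (y : ℤ) (s : List ℤ) →
  ∑ H (insertSigned k (y ∷ s))
  ≡ H (+ k ∷ y ∷ s) + H (- (+ k) ∷ y ∷ s) + ∑ (H ∘ (y ∷_)) (insertSigned k s)
∑-insertSigned-∷ H k y s = begin
  ∑ H (insertAll (+ k) (y ∷ s) ++ insertAll (- (+ k)) (y ∷ s))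
    ≡⟨ ∑-++ H (insertAll (+ k) (y ∷ s)) _ ⟩
  H (+ k ∷ y ∷ s) + ∑ H (map (y ∷_) ins₊) + (H (- (+ k) ∷ y ∷ s) + ∑ H (map (y ∷_) ins₋))
    ≡⟨ interchange (H (+ k ∷ y ∷ s)) _ _ _ ⟩
  H (+ k ∷ y ∷ s) + H (- (+ k) ∷ y ∷ s) + (∑ H (map (y ∷_) ins₊) + ∑ H (map (y ∷_) ins₋))
    ≡⟨ cong (_+_ (H (+ k ∷ y ∷ s) + H (- (+ k) ∷ y ∷ s))) (sym (∑-++ H (map (y ∷_) ins₊) _)) ⟩
  H (+ k ∷ y ∷ s) + H (- (+ k) ∷ y ∷ s) + ∑ H (map (y ∷_) ins₊ ++ map (y ∷_) ins₋)
    ≡⟨ cong (λ L → H (+ k ∷ y ∷ s) + H (- (+ k) ∷ y ∷ s) + ∑ H L)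
            (sym (List.map-++ (y ∷_) ins₊ ins₋)) ⟩
  H (+ k ∷ y ∷ s) + H (- (+ k) ∷ y ∷ s) + ∑ H (map (y ∷_) (insertSigned k s))
    ≡⟨ cong (_+_ (H (+ k ∷ y ∷ s) + H (- (+ k) ∷ y ∷ s))) (∑-map H (y ∷_) (insertSigned k s)) ⟩
  H (+ k ∷ y ∷ s) + H (- (+ k) ∷ y ∷ s) + ∑ (H ∘ (y ∷_)) (insertSigned k s) ∎
  where
  open ≡-Reasoning
  ins₊ ins₋ : List (List ℤ)
  ins₊ = insertAll (+ k) s
  ins₋ = insertAll (- (+ k)) s

∑-signings-insertAll : (H : List ℤ → ℕ) (k : ℕ) (l : List ℕ) →
  ∑ (∑ H ∘ signings) (insertAll k l) ≡ ∑ (∑ H ∘ insertSigned k) (signings l)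
∑-signings-insertAll H k []      = refl
∑-signings-insertAll H k (y ∷ l) = begin
  ∑ H (signings (k ∷ y ∷ l)) + ∑ (∑ H ∘ signings) (map (y ∷_) (insertAll k l))
    ≡⟨ cong₂ _+_ (trans (∑-signings-∷ H k (y ∷ l)) (∑-signings-∷ Hₖ y l)) inserted ⟩
  ∑ (λ s → Hₖ (+ y ∷ s) + Hₖ (- (+ y) ∷ s)) (signings l) + ∑ (∑ Hᵧ ∘ insertSigned k) (signings l)
    ≡⟨ sym (∑-+ _ _ (signings l)) ⟩
  ∑ (λ s → Hₖ (+ y ∷ s) + Hₖ (- (+ y) ∷ s) + ∑ Hᵧ (insertSigned k s)) (signings l)
    ≡⟨ ∑-cong regroup (signings l) ⟩
  ∑ (λ s → ∑ H (insertSigned k (+ y ∷ s)) + ∑ H (insertSigned k (- (+ y) ∷ s))) (signings l)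
    ≡⟨ sym (∑-signings-∷ (∑ H ∘ insertSigned k) y l) ⟩
  ∑ (∑ H ∘ insertSigned k) (signings (y ∷ l)) ∎
  where
  open ≡-Reasoning
  Hₖ Hᵧ : List ℤ → ℕ
  Hₖ s = H (+ k ∷ s) + H (- (+ k) ∷ s)
  Hᵧ s = H (+ y ∷ s) + H (- (+ y) ∷ s)

  inserted : ∑ (∑ H ∘ signings) (map (y ∷_) (insertAll k l)) ≡ ∑ (∑ Hᵧ ∘ insertSigned k) (signings l)
  inserted = begin
    ∑ (∑ H ∘ signings) (map (y ∷_) (insertAll k l)) ≡⟨ ∑-map _ (y ∷_) (insertAll k l) ⟩
    ∑ (λ t → ∑ H (signings (y ∷ t))) (insertAll k l) ≡⟨ ∑-cong (∑-signings-∷ H y) (insertAll k l) ⟩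
    ∑ (∑ Hᵧ ∘ signings) (insertAll k l)             ≡⟨ ∑-signings-insertAll Hᵧ k l ⟩
    ∑ (∑ Hᵧ ∘ insertSigned k) (signings l)          ∎

  regroup : ∀ s → Hₖ (+ y ∷ s) + Hₖ (- (+ y) ∷ s) + ∑ Hᵧ (insertSigned k s)
                  ≡ ∑ H (insertSigned k (+ y ∷ s)) + ∑ H (insertSigned k (- (+ y) ∷ s))
  regroup s = begin
    Hₖ (+ y ∷ s) + Hₖ (- (+ y) ∷ s) + ∑ Hᵧ (insertSigned k s)
      ≡⟨ cong (_+_ (Hₖ (+ y ∷ s) + Hₖ (- (+ y) ∷ s))) (∑-+ _ _ (insertSigned k s)) ⟩
    Hₖ (+ y ∷ s) + Hₖ (- (+ y) ∷ s)
      + (∑ (H ∘ (+ y ∷_)) (insertSigned k s) + ∑ (H ∘ (- (+ y) ∷_)) (insertSigned k s))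
      ≡⟨ interchange (Hₖ (+ y ∷ s)) _ _ _ ⟩
    Hₖ (+ y ∷ s) + ∑ (H ∘ (+ y ∷_)) (insertSigned k s)
      + (Hₖ (- (+ y) ∷ s) + ∑ (H ∘ (- (+ y) ∷_)) (insertSigned k s))
      ≡⟨ sym (cong₂ _+_ (∑-insertSigned-∷ H k (+ y) s) (∑-insertSigned-∷ H k (- (+ y)) s)) ⟩
    ∑ H (insertSigned k (+ y ∷ s)) + ∑ H (insertSigned k (- (+ y) ∷ s)) ∎

B-suc : ∀ m (H : List ℤ → ℕ) → ∑ H (B (suc m)) ≡ ∑ (λ u → ∑ H (insertSigned 1 (map sucAbs u))) (B m)
B-suc m H = begin
  ∑ H (concatMap signings (perms (map suc (upTo (suc m)))))
    ≡⟨ cong (λ l → ∑ H (concatMap signings (perms l))) upTo-suc ⟩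
  ∑ H (concatMap signings (concatMap (insertAll 1) (perms (map suc Y))))
    ≡⟨ ∑-concatMap H signings (concatMap (insertAll 1) (perms (map suc Y))) ⟩
  ∑ (∑ H ∘ signings) (concatMap (insertAll 1) (perms (map suc Y)))
    ≡⟨ ∑-concatMap _ (insertAll 1) (perms (map suc Y)) ⟩
  ∑ (λ σ → ∑ (∑ H ∘ signings) (insertAll 1 σ)) (perms (map suc Y))
    ≡⟨ ∑-cong (∑-signings-insertAll H 1) (perms (map suc Y)) ⟩
  ∑ (∑ G ∘ signings) (perms (map suc Y))
    ≡⟨ ∑-perms-map (∑ G ∘ signings) suc Y ⟩
  ∑ (∑ G ∘ signings ∘ map suc) (perms Y)
    ≡⟨ ∑-perms-map (∑ G ∘ signings ∘ map suc) suc (upTo m) ⟩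
  ∑ (λ τ → ∑ G (signings (map suc (map suc τ)))) (perms (upTo m))
    ≡⟨ ∑-cong (λ τ → trans (cong (∑ G) (signings-map-suc τ)) (∑-map G (map sucAbs) (signings (map suc τ))))
              (perms (upTo m)) ⟩
  ∑ (λ τ → ∑ (G ∘ map sucAbs) (signings (map suc τ))) (perms (upTo m))
    ≡⟨ ∑-perms-map (∑ (G ∘ map sucAbs) ∘ signings) suc (upTo m) ⟨
  ∑ (∑ (G ∘ map sucAbs) ∘ signings) (perms Y)
    ≡⟨ ∑-concatMap (G ∘ map sucAbs) signings (perms Y) ⟨
  ∑ (G ∘ map sucAbs) (B m) ∎
  where
  open ≡-Reasoning
  Y : List ℕ
  Y = map suc (upTo m)
  G : List ℤ → ℕ
  G = ∑ H ∘ insertSigned 1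
  upTo-suc : map suc (upTo (suc m)) ≡ 1 ∷ map suc Y
  upTo-suc = cong (λ l → 1 ∷ map suc l) (sym (List.map-applyUpTo (λ i → i) suc m))

insertAll-↭ : {A : Set} (x : A) (xs : List A) → All (_↭ x ∷ xs) (insertAll x xs)
insertAll-↭ x []       = ↭-refl ∷ []
insertAll-↭ x (y ∷ xs) =
  ↭-refl ∷ All.map⁺ (All.map (λ p → ↭-trans (↭-prep y p) (↭-swap y x ↭-refl)) (insertAll-↭ x xs))

perms-↭ : {A : Set} (xs : List A) → All (_↭ xs) (perms xs)
perms-↭ []       = ↭-refl ∷ []
perms-↭ (x ∷ xs) = All.concat⁺ (All.map⁺ (All.map
  (λ {σ} σ↭xs → All.map (λ p → ↭-trans p (↭-prep x σ↭xs)) (insertAll-↭ x σ)) (perms-↭ xs)))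

signings-∣∣ : ∀ l → All (λ s → map ℤ.∣_∣ s ≡ l) (signings l)
signings-∣∣ []      = refl ∷ []
signings-∣∣ (k ∷ l) = All.concat⁺ (All.map⁺ (All.map
  (λ e → cong (k ∷_) e ∷ cong₂ _∷_ (ℤ.∣-i∣≡∣i∣ (+ k)) e ∷ []) (signings-∣∣ l)))

B-∣∣ : ∀ m → All (λ u → map ℤ.∣_∣ u ↭ map suc (upTo m)) (B m)
B-∣∣ m = All.concat⁺ (All.map⁺ (All.map
  (λ σ↭ → All.map (λ e → subst (_↭ map suc (upTo m)) (sym e) σ↭) (signings-∣∣ _))
  (perms-↭ (map suc (upTo m)))))

B-length : ∀ m → All (λ u → length u ≡ m) (B m)
B-length m = All.map (λ {u} p → trans (sym (List.length-map ℤ.∣_∣ u))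
                                  (trans (↭-length p) (trans (List.length-map suc (upTo m)) (List.length-upTo m))))
                     (B-∣∣ m)

B-nonzero : ∀ m → All (All (λ x → ℤ.∣ x ∣ ≢ 0)) (B m)
B-nonzero m =
  All.map (λ p → All.map⁻ (All-resp-↭ (↭-sym p) (All.map⁺ {P = λ k → k ≢ 0} (All.universal (λ _ ()) (upTo m)))))
                      (B-∣∣ m)

fdes-≤ : ∀ u → fdes u ≤ length u + length u
fdes-≤ []      = z≤n
fdes-≤ (x ∷ r) = begin
  2 * desA (x ∷ r) + bit ⌊ x ℤ.<? + 0 ⌋   ≤⟨ ℕ.+-mono-≤ (ℕ.*-monoʳ-≤ 2 (desA-≤ x r)) (bit≤1 _) ⟩
  2 * length r + 1                       ≤⟨ ℕ.n≤1+n _ ⟩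
  suc (2 * length r + 1)                 ≡⟨ double (length r) ⟩
  suc (length r) + suc (length r)        ∎
  where
  open ℕ.≤-Reasoning
  double : ∀ l → suc (2 * l + 1) ≡ suc l + suc l
  double = solve-∀

∑-B-suc-fmaj-fdes : ∀ m (F : ℕ → ℕ → ℕ) →
  ∑ (λ π → F (fmaj π) (fdes π)) (B (suc m))
  ≡ ∑ (λ u → sumUpTo (suc (suc (m + m))) (λ j → F (fmaj u + j) (fdes u + fdesJump (fdes u) j))) (B m)
∑-B-suc-fmaj-fdes m F =
  trans (B-suc m (λ π → F (fmaj π) (fdes π)))
        (∑-cong-local (All.zipWith (λ {u} (len , u≢0) → insertions u len u≢0) (B-length m , B-nonzero m)))
  where
  jumps : List ℤ → ℕ → ℕ
  jumps u j = F (fmaj u + j) (fdes u + fdesJump (fdes u) j)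

  insertions : ∀ u → length u ≡ m → All (λ x → ℤ.∣ x ∣ ≢ 0) u →
    ∑ (λ π → F (fmaj π) (fdes π)) (insertSigned 1 (map sucAbs u)) ≡ sumUpTo (suc (suc (m + m))) (jumps u)
  insertions u len u≢0 = trans (insertSigned-sucAbs F u u≢0)
    (cong (λ k → sumUpTo k (jumps u)) (trans (cong (λ l → suc l + suc l) len) (cong suc (ℕ.+-suc m m))))

-- Coefficients of the recurrence

sumUpTo-fdesJump : (K : ℕ → ℕ → ℕ) {N B : ℕ} → B ≤ N →
  sumUpTo (suc (suc N)) (λ j → K j (B + fdesJump B j))
  ≡ sumUpTo (suc B) (λ j → K j B) + (K (suc B) (suc B) + sumUpTo (N ∸ B) (λ j → K (2 + B + j) (2 + B)))
sumUpTo-fdesJump K {N} {B} B≤N = begin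
  sumUpTo (suc (suc N)) Φ
    ≡⟨ cong (λ n → sumUpTo (suc n) Φ) (trans (cong suc (sym (ℕ.m+[n∸m]≡n B≤N))) (sym (ℕ.+-suc B (N ∸ B)))) ⟩
  sumUpTo (suc B + suc (N ∸ B)) Φ
    ≡⟨ sumUpTo-++ (suc B) (suc (N ∸ B)) Φ ⟩
  sumUpTo (suc B) Φ + (Φ (suc B + 0) + sumUpTo (N ∸ B) (λ j → Φ (suc B + suc j)))
    ≡⟨ cong₂ _+_ (sumUpTo-cong (suc B) flat) (cong₂ _+_ step (sumUpTo-cong (N ∸ B) (λ j _ → high j))) ⟩
  sumUpTo (suc B) (λ j → K j B) + (K (suc B) (suc B) + sumUpTo (N ∸ B) (λ j → K (2 + B + j) (2 + B))) ∎
  where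
  open ≡-Reasoning
  Φ : ℕ → ℕ
  Φ j = K j (B + fdesJump B j)

  flat : ∀ j → j < suc B → Φ j ≡ K j B
  flat j (s≤s j≤B) = cong (K j) (trans (cong (_+_ B) (fdesJump-≤ j≤B)) (ℕ.+-identityʳ B))

  step : Φ (suc B + 0) ≡ K (suc B) (suc B)
  step rewrite ℕ.+-identityʳ B = cong (K (suc B)) (trans (cong (_+_ B) (fdesJump-suc B)) (ℕ.+-comm B 1))

  high : ∀ j → Φ (suc B + suc j) ≡ K (2 + B + j) (2 + B)
  high j rewrite ℕ.+-suc B j =
    cong (K (2 + B + j)) (trans (cong (_+_ B) (fdesJump-≥ (s≤s (s≤s (ℕ.m≤m+n B j))))) (ℕ.+-comm B 2))

-- The coefficient of the recurrence at q^A t^B, with the two negative sums coming from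
-- 1 - t moved to the right-hand side.
recurrence-count : (I : ℕ → ℕ → ℕ) (N A B : ℕ) → B ≤ N →
  let Sh = λ p q → sumUpTo B (λ j → I (p + (A + j)) q) in
  I A B + (I (suc A) (suc B) + sumUpTo N (λ j → I (2 + j + A) (2 + B))) + (Sh 1 B + Sh 2 (suc B))
  ≡ sumUpTo (suc (suc N)) (λ j → I (A + j) (B + fdesJump B j)) + (Sh 1 (suc B) + Sh 2 (2 + B))
recurrence-count I N A B B≤N = begin
  I A B + (I (suc A) (suc B) + X) + (S₁ + S₂)    ≡⟨ regroup (I A B) (I (suc A) (suc B)) X S₁ S₂ ⟩
  (I A B + S₁) + ((I (suc A) (suc B) + S₂) + X)  ≡⟨ cong₂ (λ u v → u + (v + X)) first second ⟩
  T₁ + ((S₃ + Φ₁) + X)                          ≡⟨ cong (λ v → T₁ + ((S₃ + Φ₁) + v)) rest ⟩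
  T₁ + ((S₃ + Φ₁) + (S₄ + T₃))                  ≡⟨ regroup′ T₁ S₃ Φ₁ S₄ T₃ ⟩
  T₁ + (Φ₁ + T₃) + (S₃ + S₄)
    ≡⟨ cong (λ t → t + (S₃ + S₄)) (sumUpTo-fdesJump (λ j → I (A + j)) B≤N) ⟨
  sumUpTo (suc (suc N)) (λ j → I (A + j) (B + fdesJump B j)) + (S₃ + S₄) ∎
  where
  open ≡-Reasoning
  Sh : ℕ → ℕ → ℕ
  Sh p q = sumUpTo B (λ j → I (p + (A + j)) q)
  X S₁ S₂ S₃ S₄ T₁ Φ₁ T₃ : ℕ
  X = sumUpTo N (λ j → I (2 + j + A) (2 + B))
  S₁ = Sh 1 B
  S₂ = Sh 2 (suc B)
  S₃ = Sh 1 (suc B)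
  S₄ = Sh 2 (2 + B)
  T₁ = sumUpTo (suc B) (λ j → I (A + j) B)
  Φ₁ = I (A + suc B) (suc B)
  T₃ = sumUpTo (N ∸ B) (λ j → I (A + (2 + B + j)) (2 + B))

  regroup : ∀ a b x s t → a + (b + x) + (s + t) ≡ (a + s) + ((b + t) + x)
  regroup = solve-∀
  regroup′ : ∀ t s f u v → t + ((s + f) + (u + v)) ≡ t + (f + v) + (s + u)
  regroup′ = solve-∀

  first : I A B + S₁ ≡ T₁
  first = cong₂ _+_ (cong (λ x → I x B) (sym (ℕ.+-identityʳ A)))
                    (sumUpTo-cong B (λ j _ → cong (λ x → I x B) (sym (ℕ.+-suc A j))))

  second : I (suc A) (suc B) + S₂ ≡ S₃ + Φ₁
  second = begin
    I (suc A) (suc B) + S₂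
      ≡⟨ cong₂ _+_ (cong (λ x → I (suc x) (suc B)) (sym (ℕ.+-identityʳ A)))
                   (sumUpTo-cong B (λ j _ → cong (λ x → I (suc x) (suc B)) (sym (ℕ.+-suc A j)))) ⟩
    sumUpTo (suc B) (λ j → I (suc (A + j)) (suc B))
      ≡⟨ sumUpTo-suc B (λ j → I (suc (A + j)) (suc B)) ⟩
    S₃ + I (suc (A + B)) (suc B)
      ≡⟨ cong (λ x → S₃ + I x (suc B)) (sym (ℕ.+-suc A B)) ⟩
    S₃ + Φ₁ ∎

  rest : X ≡ S₄ + T₃
  rest = begin
    X
      ≡⟨ cong (λ n → sumUpTo n (λ j → I (2 + j + A) (2 + B))) (sym (ℕ.m+[n∸m]≡n B≤N)) ⟩
    sumUpTo (B + (N ∸ B)) (λ j → I (2 + j + A) (2 + B))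
      ≡⟨ sumUpTo-++ B (N ∸ B) (λ j → I (2 + j + A) (2 + B)) ⟩
    sumUpTo B (λ j → I (2 + j + A) (2 + B)) + sumUpTo (N ∸ B) (λ j → I (2 + (B + j) + A) (2 + B))
      ≡⟨ cong₂ _+_ (sumUpTo-cong B (λ j _ → cong (λ x → I (2 + x) (2 + B)) (ℕ.+-comm j A)))
                   (sumUpTo-cong (N ∸ B) (λ j _ → cong (λ x → I x (2 + B)) (ℕ.+-comm (2 + (B + j)) A))) ⟩
    S₄ + T₃ ∎

pos-cancel : ∀ {p s t s′} → p + s ≡ t + s′ → + p ℤ.+ (+ s ℤ.- + s′) ≡ + t
pos-cancel {p} {s} {t} {s′} eq = begin
  + p ℤ.+ (+ s ℤ.- + s′)   ≡⟨ ℤ.+-assoc (+ p) (+ s) (- (+ s′)) ⟨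
  + (p + s) ℤ.- + s′       ≡⟨ cong (λ n → + n ℤ.- + s′) eq ⟩
  + (t + s′) ℤ.- + s′      ≡⟨ cancel (+ t) (+ s′) ⟩
  + t                      ∎
  where
  open ≡-Reasoning
  cancel : ∀ x y → x ℤ.+ y ℤ.- y ≡ x
  cancel = ℤ-Solver.solve-∀

factor₁ : ℕ → Poly
factor₁ N = 1P +P mono (+ 1) 1 1 +P (mono (+ 1) 2 2 *P qint N)

factor₂ : Poly
factor₂ = mono (+ 1) 1 1 *P (1P +P mono (- (+ 1)) 0 1) *P (1P +P mono (+ 1) 1 1)

recurrence : ℕ → Poly → Poly
recurrence N P = factor₁ N *P P +P factor₂ *P δt P

qint-shift : ∀ A B L → (mono (+ 1) 2 2 *P map (λ j → (+ 1 , j , 0)) L) *P [ (+ 1 , A , B) ]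
                       ≡ map (λ j → (+ 1 , 2 + j + A , 2 + B)) L
qint-shift A B []      = refl
qint-shift A B (j ∷ L) = cong ((+ 1 , 2 + j + A , 2 + B) ∷_) (qint-shift A B L)

eqBit : ℕ → ℕ → ℕ → ℕ → ℕ
eqBit a b a′ b′ = bit (⌊ a ℕ.≟ a′ ⌋ ∧ ⌊ b ℕ.≟ b′ ⌋)

scale : Term → Term → Term
scale (c , a , b) (d , a′ , b′) = (c ℤ.* d , a + a′ , b + b′)

term : List ℤ → Term
term π = (+ 1 , fmaj π , fdes π)

S≡map-term-B : ∀ m → S m ≡ map term (B m)
S≡map-term-B zero    = refl
S≡map-term-B (suc m) = refl

module _ (a b : ℕ) where

  coeff-∷ : ∀ p q P → coeff a b ((+ 1 , p , q) ∷ P) ≡ + eqBit a b p q ℤ.+ coeff a b P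
  coeff-∷ p q P with ⌊ a ℕ.≟ p ⌋ ∧ ⌊ b ℕ.≟ q ⌋
  ... | true  = refl
  ... | false = refl

  coeff-++ : ∀ P Q → coeff a b (P ++ Q) ≡ coeff a b P ℤ.+ coeff a b Q
  coeff-++ []      Q = sym (ℤ.+-identityˡ _)
  coeff-++ ((c , a′ , b′) ∷ P) Q = trans (cong (ℤ._+_ head) (coeff-++ P Q)) (sym (ℤ.+-assoc head (coeff a b P) _))
    where
    head : ℤ
    head = if ⌊ a ℕ.≟ a′ ⌋ ∧ ⌊ b ℕ.≟ b′ ⌋ then c else + 0

  coeff-count : {A : Set} (c : ℤ) (f g : A → ℕ) (L : List A) →
                coeff a b (map (λ u → (c , f u , g u)) L) ≡ c ℤ.* + ∑ (λ u → eqBit a b (f u) (g u)) L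
  coeff-count c f g []      = sym (ℤ.*-zeroʳ c)
  coeff-count c f g (u ∷ L) =
    trans (cong (ℤ._+_ (if β then c else + 0)) (coeff-count c f g L)) (step β)
    where
    β : Bool
    β = ⌊ a ℕ.≟ f u ⌋ ∧ ⌊ b ℕ.≟ g u ⌋
    step : ∀ β {n} → (if β then c else + 0) ℤ.+ c ℤ.* + n ≡ c ℤ.* + (bit β + n)
    step true  {n} = distrib c (+ n)
      where
      distrib : ∀ c x → c ℤ.+ c ℤ.* x ≡ c ℤ.* (+ 1 ℤ.+ x)
      distrib = ℤ-Solver.solve-∀
    step false     = ℤ.+-identityˡ _

  coeff-*P-[] : ∀ X → coeff a b (X *P []) ≡ + 0
  coeff-*P-[] []      = refl
  coeff-*P-[] (x ∷ X) = coeff-*P-[] X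

  coeff-*P-++ : ∀ X P Q → coeff a b (X *P (P ++ Q)) ≡ coeff a b (X *P P) ℤ.+ coeff a b (X *P Q)
  coeff-*P-++ []      P Q = refl
  coeff-*P-++ (x ∷ X) P Q = begin
    coeff a b (map (scale x) (P ++ Q) ++ X *P (P ++ Q))
      ≡⟨ coeff-++ (map (scale x) (P ++ Q)) _ ⟩
    coeff a b (map (scale x) (P ++ Q)) ℤ.+ coeff a b (X *P (P ++ Q))
      ≡⟨ cong₂ ℤ._+_ (trans (cong (coeff a b) (List.map-++ (scale x) P Q)) (coeff-++ (map (scale x) P) _))
                     (coeff-*P-++ X P Q) ⟩
    (coeff a b (map (scale x) P) ℤ.+ coeff a b (map (scale x) Q)) ℤ.+ (coeff a b (X *P P) ℤ.+ coeff a b (X *P Q))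
      ≡⟨ ℤ-CS.interchange (coeff a b (map (scale x) P)) _ _ _ ⟩
    (coeff a b (map (scale x) P) ℤ.+ coeff a b (X *P P)) ℤ.+ (coeff a b (map (scale x) Q) ℤ.+ coeff a b (X *P Q))
      ≡⟨ cong₂ ℤ._+_ (sym (coeff-++ (map (scale x) P) _)) (sym (coeff-++ (map (scale x) Q) _)) ⟩
    coeff a b ((x ∷ X) *P P) ℤ.+ coeff a b ((x ∷ X) *P Q) ∎
    where open ≡-Reasoning

  coeff-∷-*P : ∀ t X P → coeff a b ((t ∷ X) *P P) ≡ coeff a b ([ t ] *P P) ℤ.+ coeff a b (X *P P)
  coeff-∷-*P t X P = trans (coeff-++ (map (scale t) P) _)
    (cong (ℤ._+ coeff a b (X *P P))
          (sym (trans (coeff-++ (map (scale t) P) []) (ℤ.+-identityʳ (coeff a b (map (scale t) P))))))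

  coeff-mono-*P : ∀ c p q {A : Set} (f g : A → ℕ) (L : List A) →
    coeff a b ([ (c , p , q) ] *P map (λ u → (+ 1 , f u , g u)) L)
    ≡ c ℤ.* + ∑ (λ u → eqBit a b (p + f u) (q + g u)) L
  coeff-mono-*P c p q f g L = begin
    coeff a b (map (scale (c , p , q)) (map (λ u → (+ 1 , f u , g u)) L) ++ [])
      ≡⟨ cong (coeff a b) (List.++-identityʳ (map (scale (c , p , q)) (map (λ u → (+ 1 , f u , g u)) L))) ⟩
    coeff a b (map (scale (c , p , q)) (map (λ u → (+ 1 , f u , g u)) L))
      ≡⟨ cong (coeff a b) (List.map-∘ L) ⟨
    coeff a b (map (λ u → (c ℤ.* + 1 , p + f u , q + g u)) L)
      ≡⟨ coeff-count (c ℤ.* + 1) (λ u → p + f u) (λ u → q + g u) L ⟩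
    c ℤ.* + 1 ℤ.* + n
      ≡⟨ cong (ℤ._* + n) (ℤ.*-identityʳ c) ⟩
    c ℤ.* + n ∎
    where
    open ≡-Reasoning
    n : ℕ
    n = ∑ (λ u → eqBit a b (p + f u) (q + g u)) L

  coeff-*P-δt-++ : ∀ X Y P Q →
    coeff a b (X *P (P ++ Q) +P Y *P δt (P ++ Q))
    ≡ coeff a b (X *P P +P Y *P δt P) ℤ.+ coeff a b (X *P Q +P Y *P δt Q)
  coeff-*P-δt-++ X Y P Q = begin
    coeff a b (X *P (P ++ Q) +P Y *P δt (P ++ Q))
      ≡⟨ coeff-++ (X *P (P ++ Q)) _ ⟩
    coeff a b (X *P (P ++ Q)) ℤ.+ coeff a b (Y *P δt (P ++ Q))
      ≡⟨ cong₂ ℤ._+_ (coeff-*P-++ X P Q)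
                     (trans (cong (λ R → coeff a b (Y *P R)) (List.concatMap-++ _ P Q))
                            (coeff-*P-++ Y (δt P) (δt Q))) ⟩
    (coeff a b (X *P P) ℤ.+ coeff a b (X *P Q)) ℤ.+ (coeff a b (Y *P δt P) ℤ.+ coeff a b (Y *P δt Q))
      ≡⟨ ℤ-CS.interchange (coeff a b (X *P P)) _ _ _ ⟩
    (coeff a b (X *P P) ℤ.+ coeff a b (Y *P δt P)) ℤ.+ (coeff a b (X *P Q) ℤ.+ coeff a b (Y *P δt Q))
      ≡⟨ cong₂ ℤ._+_ (sym (coeff-++ (X *P P) _)) (sym (coeff-++ (X *P Q) _)) ⟩
    coeff a b (X *P P +P Y *P δt P) ℤ.+ coeff a b (X *P Q +P Y *P δt Q) ∎
    where open ≡-Reasoning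

  coeff-*P-δt-map : ∀ X Y {A : Set} (h : A → Term) (F : A → ℕ) {L : List A} →
    All (λ u → coeff a b (X *P [ h u ] +P Y *P δt [ h u ]) ≡ + F u) L →
    coeff a b (X *P map h L +P Y *P δt (map h L)) ≡ + ∑ F L
  coeff-*P-δt-map X Y h F {[]} [] =
    trans (coeff-++ (X *P []) _) (cong₂ ℤ._+_ (coeff-*P-[] X) (coeff-*P-[] Y))
  coeff-*P-δt-map X Y h F {u ∷ L} (e ∷ es) =
    trans (coeff-*P-δt-++ X Y [ h u ] (map h L)) (cong₂ ℤ._+_ e (coeff-*P-δt-map X Y h F es))

  coeff-factor₁-mono : ∀ N A B →
    coeff a b (factor₁ N *P [ (+ 1 , A , B) ])
    ≡ + (eqBit a b A B + (eqBit a b (suc A) (suc B) + sumUpTo N (λ j → eqBit a b (2 + j + A) (2 + B))))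
  coeff-factor₁-mono N A B =
    trans (coeff-∷ A B ((+ 1 , suc A , suc B) ∷ shifted))
      (cong (ℤ._+_ (+ eqBit a b A B)) (trans (coeff-∷ (suc A) (suc B) shifted)
        (cong (ℤ._+_ (+ eqBit a b (suc A) (suc B))) (begin
          coeff a b shifted
            ≡⟨ cong (coeff a b) (qint-shift A B (upTo N)) ⟩
          coeff a b (map (λ j → (+ 1 , 2 + j + A , 2 + B)) (upTo N))
            ≡⟨ coeff-count (+ 1) (λ j → 2 + j + A) (λ _ → 2 + B) (upTo N) ⟩
          + 1 ℤ.* + ∑ (λ j → eqBit a b (2 + j + A) (2 + B)) (upTo N)
            ≡⟨ ℤ.*-identityˡ _ ⟩
          + ∑ (λ j → eqBit a b (2 + j + A) (2 + B)) (upTo N)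
            ≡⟨ cong +_ (∑-applyUpTo (λ j → eqBit a b (2 + j + A) (2 + B)) (λ j → j) N) ⟩
          + sumUpTo N (λ j → eqBit a b (2 + j + A) (2 + B)) ∎))))
    where
    open ≡-Reasoning
    shifted : Poly
    shifted = (mono (+ 1) 2 2 *P qint N) *P [ (+ 1 , A , B) ]

  coeff-factor₂-δt-mono : ∀ A B →
    let Sh = λ p q → sumUpTo B (λ j → eqBit a b (p + (A + j)) q) in
    coeff a b (factor₂ *P δt [ (+ 1 , A , B) ]) ≡ + (Sh 1 B + Sh 2 (suc B)) ℤ.- + (Sh 1 (suc B) + Sh 2 (2 + B))
  coeff-factor₂-δt-mono A zero    = coeff-*P-[] factor₂
  coeff-factor₂-δt-mono A (suc k) = begin
    coeff a b (factor₂ *P (D ++ []))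
      ≡⟨ cong (λ R → coeff a b (factor₂ *P R)) (List.++-identityʳ D) ⟩
    coeff a b (factor₂ *P D)
      ≡⟨ blocks ⟩
    + 1 ℤ.* + Sh 1 1 ℤ.+ (+ 1 ℤ.* + Sh 2 2 ℤ.+ (-[1+ 0 ] ℤ.* + Sh 1 2 ℤ.+ (-[1+ 0 ] ℤ.* + Sh 2 3 ℤ.+ + 0)))
      ≡⟨ signs (+ Sh 1 1) (+ Sh 2 2) (+ Sh 1 2) (+ Sh 2 3) ⟩
    + (Sh 1 1 + Sh 2 2) ℤ.- + (Sh 1 2 + Sh 2 3) ∎
    where
    open ≡-Reasoning
    D : Poly
    D = map (λ j → (+ 1 , A + j , k)) (upTo (suc k))
    Sh : ℕ → ℕ → ℕ
    Sh p q = sumUpTo (suc k) (λ j → eqBit a b (p + (A + j)) (q + k))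

    block : ∀ c p q → coeff a b ([ (c , p , q) ] *P D) ≡ c ℤ.* + Sh p q
    block c p q = trans (coeff-mono-*P c p q (_+_ A) (λ _ → k) (upTo (suc k)))
      (cong (λ n → c ℤ.* + n) (∑-applyUpTo (λ j → eqBit a b (p + (A + j)) (q + k)) (λ j → j) (suc k)))

    blocks : coeff a b (factor₂ *P D)
             ≡ + 1 ℤ.* + Sh 1 1 ℤ.+ (+ 1 ℤ.* + Sh 2 2 ℤ.+
                 (-[1+ 0 ] ℤ.* + Sh 1 2 ℤ.+ (-[1+ 0 ] ℤ.* + Sh 2 3 ℤ.+ + 0)))
    blocks =
      trans (coeff-∷-*P (+ 1 , 1 , 1) (t₂ ∷ t₃ ∷ t₄ ∷ []) D) (cong₂ ℤ._+_ (block (+ 1) 1 1)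
      (trans (coeff-∷-*P t₂ (t₃ ∷ t₄ ∷ []) D) (cong₂ ℤ._+_ (block (+ 1) 2 2)
      (trans (coeff-∷-*P t₃ (t₄ ∷ []) D) (cong₂ ℤ._+_ (block -[1+ 0 ] 1 2)
      (trans (coeff-∷-*P t₄ [] D) (cong₂ ℤ._+_ (block -[1+ 0 ] 2 3) refl)))))))
      where
      t₂ t₃ t₄ : Term
      t₂ = (+ 1 , 2 , 2)
      t₃ = (-[1+ 0 ] , 1 , 2)
      t₄ = (-[1+ 0 ] , 2 , 3)

    signs : ∀ x₁ x₂ x₃ x₄ →
            + 1 ℤ.* x₁ ℤ.+ (+ 1 ℤ.* x₂ ℤ.+ (-[1+ 0 ] ℤ.* x₃ ℤ.+ (-[1+ 0 ] ℤ.* x₄ ℤ.+ + 0)))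
                            ≡ (x₁ ℤ.+ x₂) ℤ.- (x₃ ℤ.+ x₄)
    signs = ℤ-Solver.solve-∀

  coeff-recurrence-mono : ∀ N A B → B ≤ N →
    coeff a b (recurrence N [ (+ 1 , A , B) ])
    ≡ + sumUpTo (suc (suc N)) (λ j → eqBit a b (A + j) (B + fdesJump B j))
  coeff-recurrence-mono N A B B≤N =
    trans (coeff-++ (factor₁ N *P [ (+ 1 , A , B) ]) _)
          (trans (cong₂ ℤ._+_ (coeff-factor₁-mono N A B) (coeff-factor₂-δt-mono A B))
                 (pos-cancel (recurrence-count (eqBit a b) N A B B≤N)))


  coeff-S : ∀ m → coeff a b (S m) ≡ + ∑ (λ π → eqBit a b (fmaj π) (fdes π)) (B m)
  coeff-S m = trans (cong (coeff a b) (S≡map-term-B m))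
                    (trans (coeff-count (+ 1) fmaj fdes (B m)) (ℤ.*-identityˡ _))

  coeff-recurrence-S : ∀ m →
    coeff a b (recurrence (m + m) (S m))
    ≡ + ∑ (λ u → sumUpTo (suc (suc (m + m))) (λ j → eqBit a b (fmaj u + j) (fdes u + fdesJump (fdes u) j))) (B m)
  coeff-recurrence-S m = trans (cong (coeff a b ∘ recurrence (m + m)) (S≡map-term-B m))
    (coeff-*P-δt-map (factor₁ (m + m)) factor₂ term _
      (All.map (λ {u} len → coeff-recurrence-mono (m + m) (fmaj u) (fdes u)
                              (ℕ.≤-trans (fdes-≤ u) (ℕ.≤-reflexive (cong (λ l → l + l) len))))
               (B-length m)))

theorem4p1 : (n : ℕ) → n ≥ 1 →
    S n ≈P (1P +P mono (+ 1) 1 1 +P (mono (+ 1) 2 2 *P qint (2 * n ∸ 2))) *P S (n ∸ 1)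
           +P (mono (+ 1) 1 1 *P (1P +P mono (- (+ 1)) 0 1) *P (1P +P mono (+ 1) 1 1)) *P δt (S (n ∸ 1))
theorem4p1 (suc m) _ a b = begin
  coeff a b (S (suc m))
    ≡⟨ coeff-S a b (suc m) ⟩
  + ∑ (λ π → eqBit a b (fmaj π) (fdes π)) (B (suc m))
    ≡⟨ cong +_ (∑-B-suc-fmaj-fdes m (eqBit a b)) ⟩
  + ∑ (λ u → sumUpTo (suc (suc (m + m))) (λ j → eqBit a b (fmaj u + j) (fdes u + fdesJump (fdes u) j))) (B m)
    ≡⟨ coeff-recurrence-S a b m ⟨
  coeff a b (recurrence (m + m) (S m))
    ≡⟨ cong (λ N → coeff a b (recurrence N (S m))) (2*suc∸2 m) ⟨
  coeff a b (recurrence (2 * suc m ∸ 2) (S m)) ∎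
  where
  open ≡-Reasoning
  2*suc∸2 : ∀ m → 2 * suc m ∸ 2 ≡ m + m
  2*suc∸2 m = trans (cong (_∸ 1) (ℕ.+-suc m (m + 0))) (cong (_+_ m) (ℕ.+-identityʳ m))
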